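{- For every graph $G$: (1) $\widetilde{\omega}(G)\le\widetilde{\Delta}(G)$, unless $\widetilde{G}$ is edgeless (in which case $\widetilde{\omega}(G)\le 1$ and $\widetilde{\Delta}(G)=0$); (2) $\mathrm{cideg}(G)\le 3^{\lceil\widetilde{\Delta}(G)/3\rceil}$; (3) $\widetilde{\Delta}(G)\le\mathrm{cideg}(G)\cdot(\widetilde{\omega}(G)-1)$.
   Context: All graphs finite and simple. Two vertices are equivalent if they lie in exactly the same maximal cliques (true twins); the clique-quotient graph $\widetilde{G}$ has the classes as vertices, two distinct classes adjacent iff their vertices are adjacent in $G$. $\widetilde{\Delta}(G)$ is the maximum degree of $\widetilde{G}$. $\widetilde{\omega}(G)$ is the maximum, over maximal cliques $K$ of $G$, of the number of classes intersecting $K$. $\mathrm{cideg}(G)$ is the maximum over vertices of the number of maximal cliques containing that vertex. -}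

module Defs where

open import Data.Bool using (Bool; true; false; _∧_; _∨_; not; if_then_else_)
open import Data.Nat using (ℕ; zero; suc; _⊔_; _/_; _+_)
open import Data.Fin using (Fin; _<?_)
open import Data.Fin.Properties using (_≟_)
open import Data.Vec using (Vec; []; _∷_; lookup)
open import Data.List using (List; []; _∷_; map; filter; length; foldr; allFin; _++_)
open import Data.Bool.ListAction using (all; any)
import Data.Bool as B
open import Relation.Nullary.Decidable using (⌊_⌋)
open import Relation.Binary.PropositionalEquality using (_≡_)

record Graph (n : ℕ) : Set where
  field
    adj    : Fin n → Fin n → Bool
    sym    : ∀ u v → adj u v ≡ adj v u
    irrefl : ∀ v → adj v v ≡ false
open Graph public

-- Vertex subsets (stdlib Data.Fin.Subset convention: Vec Bool n, true = inside).
VSet : ℕ → Set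
VSet n = Vec Bool n

_∈ᵇ_ : ∀ {n} → Fin n → VSet n → Bool
v ∈ᵇ S = lookup S v

allSubsets : (n : ℕ) → List (VSet n)
allSubsets zero = [] ∷ []
allSubsets (suc n) = map (true ∷_) (allSubsets n) ++ map (false ∷_) (allSubsets n)

vertices : (n : ℕ) → List (Fin n)
vertices n = allFin n

_≠ᵇ_ : ∀ {n} → Fin n → Fin n → Bool
u ≠ᵇ v = not ⌊ u ≟ v ⌋

_⇒ᵇ_ : Bool → Bool → Bool
a ⇒ᵇ b = not a ∨ b

_⊆ᵇ_ : ∀ {n} → VSet n → VSet n → Bool
_⊆ᵇ_ {n} S T = all (λ v → (v ∈ᵇ S) ⇒ᵇ (v ∈ᵇ T)) (vertices n)

module _ {n : ℕ} (G : Graph n) where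

  isClique : VSet n → Bool
  isClique S = all (λ u → all (λ v →
                 ((u ∈ᵇ S) ∧ (v ∈ᵇ S) ∧ (u ≠ᵇ v)) ⇒ᵇ adj G u v) (vertices n)) (vertices n)

  isMaxClique : VSet n → Bool
  isMaxClique S = isClique S ∧
    all (λ T → (isClique T ∧ (S ⊆ᵇ T)) ⇒ᵇ (T ⊆ᵇ S)) (allSubsets n)

  maxCliques : List (VSet n)
  maxCliques = filter (λ S → (isMaxClique S B.≟ true)) (allSubsets n)

  -- true twins: contained in exactly the same maximal cliques
  equiv : Fin n → Fin n → Bool
  equiv u v = all (λ K → ⌊ (u ∈ᵇ K) B.≟ (v ∈ᵇ K) ⌋) maxCliques

  isRep : Fin n → Bool
  isRep v = all (λ u → ⌊ u <? v ⌋ ⇒ᵇ not (equiv u v)) (vertices n)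

  -- the vertices of the clique-quotient graph (one representative per class)
  classes : List (Fin n)
  classes = filter (λ r → (isRep r B.≟ true)) (vertices n)

  quotAdj : Fin n → Fin n → Bool
  quotAdj u v = not (equiv u v) ∧ adj G u v

  quotDeg : Fin n → ℕ
  quotDeg v = length (filter (λ r → (quotAdj r v B.≟ true)) classes)

  listMax : List ℕ → ℕ
  listMax = foldr _⊔_ 0

  Δ̃ : ℕ
  Δ̃ = listMax (map quotDeg classes)

  classesMeeting : VSet n → ℕ
  classesMeeting K =
    length (filter (λ r → (any (λ v → (v ∈ᵇ K) ∧ equiv r v) (vertices n) B.≟ true)) classes)

  ω̃ : ℕ
  ω̃ = listMax (map classesMeeting maxCliques)

  cideg : ℕ
  cideg = listMax (map (λ v → length (filter (λ K → ((v ∈ᵇ K) B.≟ true)) maxCliques)) (vertices n))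

  QuotEdgeless : Set
  QuotEdgeless = ∀ r s → quotAdj r s ≡ false

ceil3 : ℕ → ℕ
ceil3 m = (m + 2) / 3

module Submission where

open import Defs
open import Data.Nat using (ℕ; _≤_; _∸_; _*_; _^_)
open import Data.Product using (_×_)
open import Relation.Nullary using (¬_)
open import Relation.Binary.PropositionalEquality using (_≡_)

import Data.Bool as B
import Data.List.Relation.Unary.All.Properties as Allₚ
import Data.List.Relation.Unary.AllPairs.Properties as AllPairsₚ
import Data.List.Relation.Unary.Unique.Propositional.Properties as Uniqueₚ
open import Data.Bool using (Bool; true; false; _∧_; _∨_; not)
open import Data.Bool.ListAction using (all; any)
open import Data.Bool.Properties using (∧-zeroʳ)
open import Data.Empty using (⊥; ⊥-elim)
open import Data.Fin using (Fin; toℕ)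
open import Data.Fin.Properties using (_≟_; any?; <-cmp)
open import Data.List using (List; []; _∷_; map; filter; length; foldr; allFin)
open import Data.List.Membership.Propositional using (_∈_)
open import Data.List.Membership.Propositional.Properties
  using (∈-filter⁺; ∈-filter⁻; ∈-allFin; ∈-map⁺; ∈-map⁻; ∈-++⁺ˡ; ∈-++⁺ʳ)
open import Data.List.Properties using (length-filter; length-tabulate)
open import Data.List.Relation.Unary.All as All using (All; []; _∷_)
open import Data.List.Relation.Unary.AllPairs using (AllPairs; []; _∷_)
open import Data.List.Relation.Unary.Any using (here; there)
open import Data.List.Relation.Unary.Unique.Propositional using (Unique)
open import Data.List.Relation.Unary.Unique.Propositional.Properties using (allFin⁺)
open import Data.Nat using (zero; suc; _+_; _<_; z≤n; s≤s; _⊔_; _%_)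
open import Data.Nat.DivMod using (m≡m%n+[m/n]*n; m%n<n)
open import Data.Nat.ListAction using (sum)
open import Data.Nat.Properties hiding (_≟_; <-cmp)
open import Data.Nat.Solver using (module +-*-Solver)
open +-*-Solver using (solve; _:+_; _:*_; _:^_; _:=_; con)
open import Data.Product using (∃; _,_; proj₁; proj₂)
open import Data.Sum using (_⊎_; inj₁; inj₂)
open import Data.Vec using ([]; _∷_; lookup; tabulate; replicate)
open import Data.Vec.Properties using (lookup∘tabulate; tabulate∘lookup; tabulate-cong; lookup-replicate; ∷-injectiveʳ)
open import Function using (_∘_; id)
open import Relation.Binary.Definitions using (tri<; tri≈; tri>)
open import Relation.Binary.PropositionalEquality
  using (refl; trans; cong; subst; module ≡-Reasoning) renaming (sym to ≡-sym)
open import Relation.Nullary using (Dec; yes; no; ¬?)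
open import Relation.Nullary.Decidable using (⌊_⌋; _×-dec_; decidable-stable)

-- (1) If a maximal clique K meets two distinct classes u and v, some maximal clique K′ separates them,
-- say u ∈ K′ ∌ v. Maximality of K′ gives x ∈ K′ non-adjacent to v, so x ∉ K; then the other classes
-- meeting K, together with the class of x, are quotient neighbours of u, whence ω̃ ≤ deg u ≤ Δ̃.
-- (2) The maximal cliques through v restrict to distinct maximal cliques of the quotient neighbourhood
-- of the class of v, a set of at most Δ̃ classes. A Moon–Moser argument bounds the number of such
-- cliques by 3^(d/3): every one of them contains a non-neighbour of a vertex p of maximum degree, and
-- those through a fixed non-neighbour q live in the neighbourhood of q. In ℕ this is stated cubed.
-- (3) Every quotient neighbour of a class a shares a maximal clique with a, and each of the at most
-- cideg maximal cliques through a meets at most ω̃ − 1 classes besides a.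

∧-true⁻ : ∀ {a b} → a ∧ b ≡ true → a ≡ true × b ≡ true
∧-true⁻ {true} {true} _ = refl , refl

∧-true⁺ : ∀ {a b} → a ≡ true → b ≡ true → a ∧ b ≡ true
∧-true⁺ refl refl = refl

∧-false⁻ : ∀ {a b} → a ∧ b ≡ false → a ≡ true → b ≡ false
∧-false⁻ e refl = e

⇒ᵇ-true⁻ : ∀ {a b} → (a ⇒ᵇ b) ≡ true → a ≡ true → b ≡ true
⇒ᵇ-true⁻ {true} e refl = e

⇒ᵇ-true⁺ : ∀ {a b} → (a ≡ true → b ≡ true) → (a ⇒ᵇ b) ≡ true
⇒ᵇ-true⁺ {false} _ = refl
⇒ᵇ-true⁺ {true} h = h refl

⇒ᵇ-false⁻ : ∀ {a b} → (a ⇒ᵇ b) ≡ false → a ≡ true × b ≡ false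
⇒ᵇ-false⁻ {true} {false} _ = refl , refl

not-true⁻ : ∀ {b} → not b ≡ true → b ≡ false
not-true⁻ {false} _ = refl

not-true⁺ : ∀ {b} → b ≡ false → not b ≡ true
not-true⁺ refl = refl

true≢false : ∀ {b} → b ≡ true → b ≡ false → ⊥
true≢false refl ()

≢true⇒≡false : ∀ {b} → ¬ b ≡ true → b ≡ false
≢true⇒≡false {false} _ = refl
≢true⇒≡false {true} h = ⊥-elim (h refl)

module _ {P : Set} where

  ⌊⌋-true⁻ : {d : Dec P} → ⌊ d ⌋ ≡ true → P
  ⌊⌋-true⁻ {yes p} _ = p

  ⌊⌋-true⁺ : {d : Dec P} → P → ⌊ d ⌋ ≡ true
  ⌊⌋-true⁺ {yes _} _ = refl
  ⌊⌋-true⁺ {no ¬p} p = ⊥-elim (¬p p)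

  ⌊⌋-false⁻ : {d : Dec P} → ⌊ d ⌋ ≡ false → ¬ P
  ⌊⌋-false⁻ {no ¬p} _ = ¬p

module _ {A : Set} {p : A → Bool} where

  all-true⁻ : ∀ {xs x} → all p xs ≡ true → x ∈ xs → p x ≡ true
  all-true⁻ {y ∷ _} e (here refl) = proj₁ (∧-true⁻ e)
  all-true⁻ {y ∷ _} e (there m) = all-true⁻ (proj₂ (∧-true⁻ {p y} e)) m

  all-true⁺ : ∀ xs → (∀ {x} → x ∈ xs → p x ≡ true) → all p xs ≡ true
  all-true⁺ [] _ = refl
  all-true⁺ (_ ∷ ys) h = ∧-true⁺ (h (here refl)) (all-true⁺ ys (h ∘ there))

  all-false⁻ : ∀ xs → all p xs ≡ false → ∃ λ x → x ∈ xs × p x ≡ false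
  all-false⁻ (y ∷ ys) e with p y in py
  ... | false = y , here refl , py
  ... | true with all-false⁻ ys e
  ... | x , m , q = x , there m , q

  any-true⁻ : ∀ xs → any p xs ≡ true → ∃ λ x → x ∈ xs × p x ≡ true
  any-true⁻ (y ∷ ys) e with p y in py
  ... | true = y , here refl , py
  ... | false with any-true⁻ ys e
  ... | x , m , q = x , there m , q

  any-true⁺ : ∀ {xs x} → x ∈ xs → p x ≡ true → any p xs ≡ true
  any-true⁺ {y ∷ _} (here refl) e rewrite e = refl
  any-true⁺ {y ∷ _} (there m) e with p y
  ... | true = refl
  ... | false = any-true⁺ m e

indicator : Bool → ℕ
indicator true = 1
indicator false = 0

-- The shape of the filters in Defs, so that quotDeg, classesMeeting and the lengths in cideg are counts.
count : ∀ {A : Set} → (A → Bool) → List A → ℕ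
count f xs = length (filter (λ x → f x B.≟ true) xs)

module _ {A : Set} where

  count-∷ : ∀ (f : A → Bool) x xs → count f (x ∷ xs) ≡ indicator (f x) + count f xs
  count-∷ f x xs with f x
  ... | true = refl
  ... | false = refl

  count-none : ∀ (f : A → Bool) xs → (∀ {x} → x ∈ xs → f x ≡ false) → count f xs ≡ 0
  count-none f [] _ = refl
  count-none f (x ∷ xs) h rewrite count-∷ f x xs | h (here refl) = count-none f xs (h ∘ there)

  count-pos⁻ : ∀ (f : A → Bool) xs → 1 ≤ count f xs → ∃ λ x → x ∈ xs × f x ≡ true
  count-pos⁻ f (x ∷ xs) p rewrite count-∷ f x xs with f x in fx
  ... | true = x , here refl , fx
  ... | false with count-pos⁻ f xs p
  ... | y , m , fy = y , there m , fy

  count-pos⁺ : ∀ (f : A → Bool) {xs y} → y ∈ xs → f y ≡ true → 1 ≤ count f xs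
  count-pos⁺ f {x ∷ xs} (here refl) fx rewrite count-∷ f x xs | fx = s≤s z≤n
  count-pos⁺ f {x ∷ xs} (there m) fy rewrite count-∷ f x xs =
    ≤-trans (count-pos⁺ f m fy) (m≤n+m _ (indicator (f x)))

  count-mono : ∀ (f g : A → Bool) xs → (∀ {x} → x ∈ xs → f x ≡ true → g x ≡ true) →
               count f xs ≤ count g xs
  count-mono f g [] _ = z≤n
  count-mono f g (x ∷ xs) h rewrite count-∷ f x xs | count-∷ g x xs with f x in fx
  ... | true rewrite h (here refl) fx = s≤s (count-mono f g xs (h ∘ there))
  ... | false = ≤-trans (count-mono f g xs (h ∘ there)) (m≤n+m _ (indicator (g x)))

  count-mono-< : ∀ (f g : A → Bool) xs → (∀ {x} → x ∈ xs → f x ≡ true → g x ≡ true) →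
                 ∀ {y} → y ∈ xs → g y ≡ true → f y ≡ false → count f xs < count g xs
  count-mono-< f g (x ∷ xs) h (here refl) gx fx rewrite count-∷ f x xs | count-∷ g x xs | gx | fx =
    s≤s (count-mono f g xs (h ∘ there))
  count-mono-< f g (x ∷ xs) h (there m) gy fy rewrite count-∷ f x xs | count-∷ g x xs with f x in fx
  ... | true rewrite h (here refl) fx = s≤s (count-mono-< f g xs (h ∘ there) m gy fy)
  ... | false = ≤-trans (count-mono-< f g xs (h ∘ there) m gy fy) (m≤n+m _ (indicator (g x)))

  count-filter : ∀ (f g : A → Bool) xs →
                 count g (filter (λ x → f x B.≟ true) xs) ≡ count (λ x → f x ∧ g x) xs
  count-filter f g [] = refl
  count-filter f g (x ∷ xs) rewrite count-∷ (λ x → f x ∧ g x) x xs with f x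
  ... | false = count-filter f g xs
  ... | true rewrite count-∷ g x (filter (λ x → f x B.≟ true) xs) =
    cong (indicator (g x) +_) (count-filter f g xs)

  count-split : ∀ (f g : A → Bool) xs →
                count f xs ≡ count (λ x → f x ∧ g x) xs + count (λ x → f x ∧ not (g x)) xs
  count-split f g [] = refl
  count-split f g (x ∷ xs) rewrite count-∷ f x xs | count-∷ (λ x → f x ∧ g x) x xs
    | count-∷ (λ x → f x ∧ not (g x)) x xs | count-split f g xs with f x | g x
  ... | true | true = refl
  ... | true | false = ≡-sym (+-suc _ _)
  ... | false | _ = refl

  count-cong : ∀ (f g : A → Bool) xs → (∀ {x} → x ∈ xs → f x ≡ g x) → count f xs ≡ count g xs
  count-cong f g [] _ = refl
  count-cong f g (x ∷ xs) h rewrite count-∷ f x xs | count-∷ g x xs | h (here refl) =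
    cong (indicator (g x) +_) (count-cong f g xs (h ∘ there))

  count-const-true : ∀ (xs : List A) → count (λ _ → true) xs ≡ length xs
  count-const-true [] = refl
  count-const-true (_ ∷ xs) = cong suc (count-const-true xs)

  count≤1 : ∀ (f : A → Bool) {xs} → Unique xs →
            (∀ {x y} → x ∈ xs → y ∈ xs → f x ≡ true → f y ≡ true → x ≡ y) → count f xs ≤ 1
  count≤1 f {[]} _ _ = z≤n
  count≤1 f {x ∷ xs} (x∉xs ∷ u) h rewrite count-∷ f x xs with f x in fx
  ... | false = count≤1 f u (λ m m′ → h (there m) (there m′))
  ... | true = ≤-reflexive (cong suc (count-none f xs rest))
    where
    rest : ∀ {y} → y ∈ xs → f y ≡ false
    rest m = ≢true⇒≡false (λ fy → All.lookup x∉xs m (h (here refl) (there m) fx fy))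

  count≤sum-count : ∀ {I : Set} (f : A → Bool) (g : I → A → Bool) is xs →
    (∀ {x} → x ∈ xs → f x ≡ true → ∃ λ i → i ∈ is × g i x ≡ true) →
    count f xs ≤ sum (map (λ i → count (g i) xs) is)
  count≤sum-count f g [] xs cover =
    ≤-reflexive (count-none f xs (λ m → ≢true⇒≡false (λ fx → no-index (cover m fx))))
    where
    no-index : ∀ {x} → (∃ λ i → i ∈ [] × g i x ≡ true) → ⊥
    no-index (_ , () , _)
  count≤sum-count f g (i ∷ is) xs cover = begin
      count f xs
    ≡⟨ count-split f (g i) xs ⟩
      count (λ x → f x ∧ g i x) xs + count (λ x → f x ∧ not (g i x)) xs
    ≤⟨ +-mono-≤ (count-mono _ (g i) xs (λ _ e → proj₂ (∧-true⁻ e)))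
                (count≤sum-count (λ x → f x ∧ not (g i x)) g is xs cover′) ⟩
      count (g i) xs + sum (map (λ i → count (g i) xs) is) ∎
    where
    open ≤-Reasoning
    cover′ : ∀ {x} → x ∈ xs → (f x ∧ not (g i x)) ≡ true → ∃ λ j → j ∈ is × g j x ≡ true
    cover′ m e with ∧-true⁻ e
    ... | fx , ¬gx with cover m fx
    ... | _ , here refl , gx = ⊥-elim (true≢false gx (not-true⁻ ¬gx))
    ... | j , there j∈is , gx = j , j∈is , gx

AllPairs-map-with-All : ∀ {A : Set} {P : A → Set} {R S : A → A → Set} →
  (∀ {x y} → P x → P y → R x y → S x y) → ∀ {xs} → All P xs → AllPairs R xs → AllPairs S xs
AllPairs-map-with-All f [] [] = []
AllPairs-map-with-All f (px ∷ pxs) (rx ∷ rxs) =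
  All.zipWith (λ (py , r) → f px py r) (pxs , rx) ∷ AllPairs-map-with-All f pxs rxs

sum-map-≤ : ∀ {I : Set} (g : I → ℕ) c is → (∀ {i} → i ∈ is → g i ≤ c) → sum (map g is) ≤ length is * c
sum-map-≤ g c [] _ = z≤n
sum-map-≤ g c (i ∷ is) h = +-mono-≤ (h (here refl)) (sum-map-≤ g c is (h ∘ there))

maximum : List ℕ → ℕ
maximum = foldr _⊔_ 0

module _ {A : Set} (f : A → ℕ) where

  ≤-maximum : ∀ {xs x} → x ∈ xs → f x ≤ maximum (map f xs)
  ≤-maximum {y ∷ _} (here refl) = m≤m⊔n (f y) _
  ≤-maximum {y ∷ _} (there m) = ≤-trans (≤-maximum m) (m≤n⊔m (f y) _)

  maximum-≤ : ∀ xs {b} → (∀ {x} → x ∈ xs → f x ≤ b) → maximum (map f xs) ≤ b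
  maximum-≤ [] _ = z≤n
  maximum-≤ (_ ∷ ys) h = ⊔-lub (h (here refl)) (maximum-≤ ys (h ∘ there))

  maximum-attained : ∀ xs → maximum (map f xs) ≡ 0 ⊎ ∃ λ x → x ∈ xs × maximum (map f xs) ≡ f x
  maximum-attained [] = inj₁ refl
  maximum-attained (x ∷ xs) with ⊔-sel (f x) (maximum (map f xs))
  ... | inj₁ e = inj₂ (x , here refl , e)
  ... | inj₂ e with maximum-attained xs
  ... | inj₁ z = inj₁ (trans e z)
  ... | inj₂ (y , m , e′) = inj₂ (y , there m , trans e e′)

  argmax-on : ∀ (P : A → Bool) xs {x} → x ∈ xs → P x ≡ true →
              ∃ λ p → P p ≡ true × ∀ {q} → q ∈ xs → P q ≡ true → f q ≤ f p
  argmax-on P xs {x} x∈xs Px with maximum-attained (filter (λ y → P y B.≟ true) xs)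
  ... | inj₁ M≡0 = x , Px , λ q∈xs Pq →
    ≤-trans (subst (f _ ≤_) M≡0 (≤-maximum (∈-filter⁺ (λ y → P y B.≟ true) q∈xs Pq))) z≤n
  ... | inj₂ (p , p∈ , M≡fp) = p , proj₂ (∈-filter⁻ (λ y → P y B.≟ true) {xs = xs} p∈) , λ q∈xs Pq →
    subst (f _ ≤_) M≡fp (≤-maximum (∈-filter⁺ (λ y → P y B.≟ true) q∈xs Pq))

-- For k ≥ 3 one has (k + 1)³ ≤ 3 k³, the difference being 2k³ − 3k² − 3k − 1.
cube-growth : ∀ j → 3 * (3 + j) ^ 3 ≡ (4 + j) ^ 3 + (17 + 33 * j + 15 * j ^ 2 + 2 * j ^ 3)
cube-growth = solve 1 (λ j → con 3 :* (con 3 :+ j) :^ 3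
                           := (con 4 :+ j) :^ 3 :+ (con 17 :+ con 33 :* j :+ con 15 :* j :^ 2 :+ con 2 :* j :^ 3)) refl

n^3≤3^n : ∀ k → k ^ 3 ≤ 3 ^ k
n^3≤3^n 0 = z≤n
n^3≤3^n 1 = s≤s z≤n
n^3≤3^n 2 = n≤1+n 8
n^3≤3^n 3 = ≤-refl
n^3≤3^n (suc (suc (suc (suc j)))) = begin
  (4 + j) ^ 3      ≤⟨ m≤m+n _ _ ⟩
  (4 + j) ^ 3 + _  ≡⟨ ≡-sym (cube-growth j) ⟩
  3 * (3 + j) ^ 3  ≤⟨ *-monoʳ-≤ 3 (n^3≤3^n (suc (suc (suc j)))) ⟩
  3 * 3 ^ (3 + j)  ∎
  where open ≤-Reasoning

m^3≤n^3⇒m≤n : ∀ {m n} → m ^ 3 ≤ n ^ 3 → m ≤ n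
m^3≤n^3⇒m≤n {m} {n} le with m ≤? n
... | yes m≤n = m≤n
... | no m≰n = ⊥-elim (<⇒≱ (^-monoˡ-< 3 (≰⇒> m≰n)) le)

[m*n]^3≡m^3*n^3 : ∀ m n → (m * n) ^ 3 ≡ m ^ 3 * n ^ 3
[m*n]^3≡m^3*n^3 = solve 2 (λ m n → (m :* n) :^ 3 := m :^ 3 :* n :^ 3) refl

sum-map-^3-≤ : ∀ {I : Set} (a : I → ℕ) is {B} → (∀ {i} → i ∈ is → a i ^ 3 ≤ B) →
               sum (map a is) ^ 3 ≤ length is ^ 3 * B
sum-map-^3-≤ a is {B} h = begin
    sum (map a is) ^ 3     ≤⟨ ^-monoˡ-≤ 3 (sum-map-≤ a M is (≤-maximum a)) ⟩
    (length is * M) ^ 3    ≡⟨ [m*n]^3≡m^3*n^3 (length is) M ⟩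
    length is ^ 3 * M ^ 3  ≤⟨ *-monoʳ-≤ (length is ^ 3) M^3≤B ⟩
    length is ^ 3 * B      ∎
  where
  open ≤-Reasoning
  M = maximum (map a is)
  M^3≤B : M ^ 3 ≤ B
  M^3≤B with maximum-attained a is
  ... | inj₁ M≡0 rewrite M≡0 = z≤n
  ... | inj₂ (i , i∈is , M≡ai) rewrite M≡ai = h i∈is

m≤⌈m/3⌉*3 : ∀ m → m ≤ ceil3 m * 3
m≤⌈m/3⌉*3 m = +-cancelˡ-≤ 2 m (ceil3 m * 3) (begin
  2 + m                            ≡⟨ +-comm 2 m ⟩
  m + 2                            ≡⟨ m≡m%n+[m/n]*n (m + 2) 3 ⟩
  (m + 2) % 3 + ceil3 m * 3        ≤⟨ +-monoˡ-≤ (ceil3 m * 3) (≤-pred (m%n<n (m + 2) 3)) ⟩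
  2 + ceil3 m * 3                  ∎)
  where open ≤-Reasoning

∈-allSubsets : ∀ {n} (S : VSet n) → S ∈ allSubsets n
∈-allSubsets [] = here refl
∈-allSubsets {suc n} (true ∷ S) = ∈-++⁺ˡ (∈-map⁺ (true ∷_) (∈-allSubsets S))
∈-allSubsets {suc n} (false ∷ S) = ∈-++⁺ʳ (map (true ∷_) (allSubsets n)) (∈-map⁺ (false ∷_) (∈-allSubsets S))

allSubsets-unique : ∀ n → Unique (allSubsets n)
allSubsets-unique zero = [] ∷ []
allSubsets-unique (suc n) =
  AllPairsₚ.++⁺ (Uniqueₚ.map⁺ ∷-injectiveʳ (allSubsets-unique n)) (Uniqueₚ.map⁺ ∷-injectiveʳ (allSubsets-unique n))
                (All.tabulate λ S∈ → All.tabulate λ T∈ → heads-differ S∈ T∈)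
  where
  heads-differ : ∀ {S T} → S ∈ map (true ∷_) (allSubsets n) → T ∈ map (false ∷_) (allSubsets n) → ¬ S ≡ T
  heads-differ S∈ T∈ with ∈-map⁻ (true ∷_) S∈ | ∈-map⁻ (false ∷_) T∈
  ... | _ , _ , refl | _ , _ , refl = λ ()

module _ {n : ℕ} where

  _⊆_ : VSet n → VSet n → Set
  S ⊆ T = ∀ v → v ∈ᵇ S ≡ true → v ∈ᵇ T ≡ true

  ⊆ᵇ-true⁻ : ∀ S T → (S ⊆ᵇ T) ≡ true → S ⊆ T
  ⊆ᵇ-true⁻ S T e v = ⇒ᵇ-true⁻ (all-true⁻ e (∈-allFin v))

  ⊆ᵇ-true⁺ : ∀ S T → S ⊆ T → (S ⊆ᵇ T) ≡ true
  ⊆ᵇ-true⁺ S T h = all-true⁺ (allFin n) (λ {v} _ → ⇒ᵇ-true⁺ (h v))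

  ⊆ᵇ-false⁻ : ∀ S T → (S ⊆ᵇ T) ≡ false → ∃ λ v → v ∈ᵇ S ≡ true × v ∈ᵇ T ≡ false
  ⊆ᵇ-false⁻ S T e with all-false⁻ (allFin n) e
  ... | v , _ , q = v , ⇒ᵇ-false⁻ q

  vset-ext : ∀ {S T : VSet n} → (∀ v → v ∈ᵇ S ≡ v ∈ᵇ T) → S ≡ T
  vset-ext {S} {T} h = trans (≡-sym (tabulate∘lookup S)) (trans (tabulate-cong h) (tabulate∘lookup T))

  size : VSet n → ℕ
  size S = count (_∈ᵇ S) (allFin n)

  size≤n : ∀ S → size S ≤ n
  size≤n S = ≤-trans (length-filter (λ v → (v ∈ᵇ S) B.≟ true) (allFin n)) (≤-reflexive (length-tabulate id))

  size-mono-< : ∀ S T → S ⊆ T → ∀ {v} → v ∈ᵇ T ≡ true → v ∈ᵇ S ≡ false → size S < size T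
  size-mono-< S T S⊆T = count-mono-< (_∈ᵇ S) (_∈ᵇ T) (allFin n) (λ {v} _ → S⊆T v) (∈-allFin _)

  insert : VSet n → Fin n → VSet n
  insert S w = tabulate (λ v → v ∈ᵇ S ∨ ⌊ v ≟ w ⌋)

  ∈-insert⁻ : ∀ S w {v} → v ∈ᵇ insert S w ≡ true → v ∈ᵇ S ≡ true ⊎ v ≡ w
  ∈-insert⁻ S w {v} e rewrite lookup∘tabulate (λ v → v ∈ᵇ S ∨ ⌊ v ≟ w ⌋) v with v ∈ᵇ S
  ... | true = inj₁ refl
  ... | false = inj₂ (⌊⌋-true⁻ e)

  ⊆-insert : ∀ S w → S ⊆ insert S w
  ⊆-insert S w v e rewrite lookup∘tabulate (λ v → v ∈ᵇ S ∨ ⌊ v ≟ w ⌋) v | e = refl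

  ∈-insert-new : ∀ S w → w ∈ᵇ insert S w ≡ true
  ∈-insert-new S w rewrite lookup∘tabulate (λ v → v ∈ᵇ S ∨ ⌊ v ≟ w ⌋) w with w ∈ᵇ S
  ... | true = refl
  ... | false = ⌊⌋-true⁺ refl

  pair : Fin n → Fin n → VSet n
  pair a b = insert (insert (replicate n false) a) b

  ∈-pair⁻ : ∀ a b {v} → v ∈ᵇ pair a b ≡ true → v ≡ a ⊎ v ≡ b
  ∈-pair⁻ a b {v} e with ∈-insert⁻ (insert (replicate n false) a) b e
  ... | inj₂ v≡b = inj₂ v≡b
  ... | inj₁ e′ with ∈-insert⁻ (replicate n false) a e′
  ... | inj₂ v≡a = inj₁ v≡a
  ... | inj₁ e″ = ⊥-elim (true≢false e″ (lookup-replicate v false))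

  ∈-pair-fst : ∀ a b → a ∈ᵇ pair a b ≡ true
  ∈-pair-fst a b = ⊆-insert (insert (replicate n false) a) b a (∈-insert-new (replicate n false) a)

  ∈-pair-snd : ∀ a b → b ∈ᵇ pair a b ≡ true
  ∈-pair-snd a b = ∈-insert-new (insert (replicate n false) a) b

module Cliques {n : ℕ} (G : Graph n) where

  IsClique : VSet n → Set
  IsClique S = ∀ u v → u ∈ᵇ S ≡ true → v ∈ᵇ S ≡ true → ¬ u ≡ v → adj G u v ≡ true

  isClique-true⁻ : ∀ S → isClique G S ≡ true → IsClique S
  isClique-true⁻ S e u v u∈S v∈S u≢v = ⇒ᵇ-true⁻ (all-true⁻ (all-true⁻ e (∈-allFin u)) (∈-allFin v))
    (∧-true⁺ u∈S (∧-true⁺ v∈S (not-true⁺ (≢true⇒≡false (u≢v ∘ ⌊⌋-true⁻)))))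

  isClique-true⁺ : ∀ S → IsClique S → isClique G S ≡ true
  isClique-true⁺ S h = all-true⁺ (allFin n) λ {u} _ → all-true⁺ (allFin n) λ {v} _ → ⇒ᵇ-true⁺ λ e →
    let u∈S , rest = ∧-true⁻ e
        v∈S , u≠v = ∧-true⁻ {v ∈ᵇ S} rest
    in h u v u∈S v∈S (⌊⌋-false⁻ (not-true⁻ u≠v))

  isMaxClique⁻ : ∀ {K} → K ∈ maxCliques G → isMaxClique G K ≡ true
  isMaxClique⁻ K∈ = proj₂ (∈-filter⁻ (λ S → isMaxClique G S B.≟ true) {xs = allSubsets n} K∈)

  isMaxClique⁺ : ∀ {K} → isMaxClique G K ≡ true → K ∈ maxCliques G
  isMaxClique⁺ {K} = ∈-filter⁺ (λ S → isMaxClique G S B.≟ true) (∈-allSubsets K)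

  maxClique-isClique : ∀ {K} → K ∈ maxCliques G → IsClique K
  maxClique-isClique {K} K∈ = isClique-true⁻ K (proj₁ (∧-true⁻ (isMaxClique⁻ K∈)))

  maxClique-maximal : ∀ {K} T → K ∈ maxCliques G → IsClique T → K ⊆ T → T ⊆ K
  maxClique-maximal {K} T K∈ cT K⊆T = ⊆ᵇ-true⁻ T K (⇒ᵇ-true⁻
    (all-true⁻ (proj₂ (∧-true⁻ {isClique G K} (isMaxClique⁻ K∈))) (∈-allSubsets T))
    (∧-true⁺ (isClique-true⁺ T cT) (⊆ᵇ-true⁺ K T K⊆T)))

  maxClique-non-neighbour : ∀ {K w} → K ∈ maxCliques G → w ∈ᵇ K ≡ false →
                            ∃ λ x → x ∈ᵇ K ≡ true × adj G x w ≡ false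
  maxClique-non-neighbour {K} {w} K∈ w∉K with any? (λ x → ((x ∈ᵇ K) B.≟ true) ×-dec (adj G x w B.≟ false))
  ... | yes (x , x∈K , x≁w) = x , x∈K , x≁w
  ... | no none = ⊥-elim (true≢false (maxClique-maximal (insert K w) K∈ clique (⊆-insert K w) w (∈-insert-new K w)) w∉K)
    where
    w-adjacent : ∀ x → x ∈ᵇ K ≡ true → adj G x w ≡ true
    w-adjacent x x∈K with adj G x w in e
    ... | true = refl
    ... | false = ⊥-elim (none (x , x∈K , e))
    clique : IsClique (insert K w)
    clique u v u∈ v∈ u≢v with ∈-insert⁻ K w u∈ | ∈-insert⁻ K w v∈
    ... | inj₁ u∈K | inj₁ v∈K = maxClique-isClique K∈ u v u∈K v∈K u≢v
    ... | inj₁ u∈K | inj₂ refl = w-adjacent u u∈K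
    ... | inj₂ refl | inj₁ v∈K = trans (Graph.sym G w v) (w-adjacent v v∈K)
    ... | inj₂ refl | inj₂ refl = ⊥-elim (u≢v refl)

  maxCliques-unique : Unique (maxCliques G)
  maxCliques-unique = Uniqueₚ.filter⁺ (λ S → isMaxClique G S B.≟ true) (allSubsets-unique n)

  cliquesAt : Fin n → List (VSet n)
  cliquesAt v = filter (λ K → (v ∈ᵇ K) B.≟ true) (maxCliques G)

  clique-grows : ∀ S → IsClique S → isMaxClique G S ≡ false →
                 ∃ λ T → IsClique T × S ⊆ T × size S < size T
  clique-grows S cS notMax with all-false⁻ (allSubsets n) (∧-false⁻ notMax (isClique-true⁺ S cS))
  ... | T , _ , bad with ⇒ᵇ-false⁻ bad
  ... | cT∧S⊆T , T⊈S with ∧-true⁻ {isClique G T} cT∧S⊆T | ⊆ᵇ-false⁻ T S T⊈S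
  ... | cT , S⊆T | v , v∈T , v∉S =
    T , isClique-true⁻ T cT , ⊆ᵇ-true⁻ S T S⊆T , size-mono-< S T (⊆ᵇ-true⁻ S T S⊆T) v∈T v∉S

  clique⊆maxClique-fuel : ∀ fuel S → IsClique S → n ≤ size S + fuel → ∃ λ K → K ∈ maxCliques G × S ⊆ K
  clique⊆maxClique-fuel fuel S cS bound with isMaxClique G S in isMax
  ... | true = S , isMaxClique⁺ isMax , λ _ v∈S → v∈S
  clique⊆maxClique-fuel zero S cS bound | false with clique-grows S cS isMax
  ... | T , _ , _ , S<T = ⊥-elim (<⇒≱ (≤-trans S<T (size≤n T)) (subst (n ≤_) (+-identityʳ _) bound))
  clique⊆maxClique-fuel (suc fuel) S cS bound | false with clique-grows S cS isMax
  ... | T , cT , S⊆T , S<T with clique⊆maxClique-fuel fuel T cT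
          (≤-trans bound (≤-trans (≤-reflexive (+-suc (size S) fuel)) (+-monoˡ-≤ fuel S<T)))
  ... | K , K∈ , T⊆K = K , K∈ , λ v v∈S → T⊆K v (S⊆T v v∈S)

  clique⊆maxClique : ∀ S → IsClique S → ∃ λ K → K ∈ maxCliques G × S ⊆ K
  clique⊆maxClique S cS = clique⊆maxClique-fuel n S cS (m≤n+m n (size S))

  edge⊆maxClique : ∀ {a b} → adj G a b ≡ true →
                   ∃ λ K → K ∈ maxCliques G × a ∈ᵇ K ≡ true × b ∈ᵇ K ≡ true
  edge⊆maxClique {a} {b} a∼b with clique⊆maxClique (pair a b) pair-clique
    where
    pair-clique : IsClique (pair a b)
    pair-clique u v u∈ v∈ u≢v with ∈-pair⁻ a b u∈ | ∈-pair⁻ a b v∈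
    ... | inj₁ refl | inj₁ refl = ⊥-elim (u≢v refl)
    ... | inj₁ refl | inj₂ refl = a∼b
    ... | inj₂ refl | inj₁ refl = trans (Graph.sym G b a) a∼b
    ... | inj₂ refl | inj₂ refl = ⊥-elim (u≢v refl)
  ... | K , K∈ , pair⊆K = K , K∈ , pair⊆K a (∈-pair-fst a b) , pair⊆K b (∈-pair-snd a b)

module Twins {n : ℕ} (G : Graph n) where
  open Cliques G

  equiv-true⁻ : ∀ {u v K} → equiv G u v ≡ true → K ∈ maxCliques G → u ∈ᵇ K ≡ v ∈ᵇ K
  equiv-true⁻ e K∈ = ⌊⌋-true⁻ (all-true⁻ e K∈)

  equiv-true⁺ : ∀ {u v} → (∀ {K} → K ∈ maxCliques G → u ∈ᵇ K ≡ v ∈ᵇ K) → equiv G u v ≡ true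
  equiv-true⁺ h = all-true⁺ (maxCliques G) (λ K∈ → ⌊⌋-true⁺ (h K∈))

  equiv-false⁻ : ∀ {u v} → equiv G u v ≡ false → ∃ λ K → K ∈ maxCliques G × ¬ u ∈ᵇ K ≡ v ∈ᵇ K
  equiv-false⁻ e with all-false⁻ (maxCliques G) e
  ... | K , K∈ , differ = K , K∈ , ⌊⌋-false⁻ differ

  equiv-refl : ∀ u → equiv G u u ≡ true
  equiv-refl u = equiv-true⁺ (λ _ → refl)

  equiv-sym : ∀ {u v} → equiv G u v ≡ true → equiv G v u ≡ true
  equiv-sym e = equiv-true⁺ (λ K∈ → ≡-sym (equiv-true⁻ e K∈))

  equiv-trans : ∀ {u v w} → equiv G u v ≡ true → equiv G v w ≡ true → equiv G u w ≡ true
  equiv-trans e f = equiv-true⁺ (λ K∈ → trans (equiv-true⁻ e K∈) (equiv-true⁻ f K∈))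

  equiv-comm : ∀ u v → equiv G u v ≡ equiv G v u
  equiv-comm u v with equiv G u v in uv | equiv G v u in vu
  ... | true | true = refl
  ... | false | false = refl
  ... | true | false = ⊥-elim (true≢false (equiv-sym uv) vu)
  ... | false | true = ⊥-elim (true≢false (equiv-sym vu) uv)

  equiv-∈ : ∀ {K a b} → K ∈ maxCliques G → equiv G a b ≡ true → b ∈ᵇ K ≡ true → a ∈ᵇ K ≡ true
  equiv-∈ K∈ e b∈K = trans (equiv-true⁻ e K∈) b∈K

  separated⇒¬equiv : ∀ {K a b} → K ∈ maxCliques G → a ∈ᵇ K ≡ true → b ∈ᵇ K ≡ false → equiv G a b ≡ false
  separated⇒¬equiv K∈ a∈K b∉K = ≢true⇒≡false (λ e → true≢false (trans (≡-sym (equiv-true⁻ e K∈)) a∈K) b∉K)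

  least-twin : ∀ k v → toℕ v < k →
               ∃ λ r → equiv G r v ≡ true × (∀ u → toℕ u < toℕ r → equiv G u v ≡ false)
  least-twin (suc k) v v<k with any? (λ u → (toℕ u <? toℕ v) ×-dec (equiv G u v B.≟ true))
  ... | no none = v , equiv-refl v , λ u u<v → ≢true⇒≡false (λ e → none (u , u<v , e))
  ... | yes (u , u<v , uv) with least-twin k u (≤-trans u<v (≤-pred v<k))
  ... | r , ru , least = r , equiv-trans ru uv ,
        λ w w<r → ≢true⇒≡false (λ wv → true≢false (equiv-trans wv (equiv-sym uv)) (least w w<r))

  rep : ∀ v → ∃ λ r → isRep G r ≡ true × equiv G r v ≡ true
  rep v with least-twin (suc (toℕ v)) v ≤-refl
  ... | r , rv , least = r , all-true⁺ (allFin n) (λ {u} _ → ⇒ᵇ-true⁺ (λ u<r →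
          not-true⁺ (≢true⇒≡false (λ ur → true≢false (equiv-trans ur rv) (least u (⌊⌋-true⁻ u<r)))))) , rv

  rep-unique : ∀ {r s} → isRep G r ≡ true → isRep G s ≡ true → equiv G r s ≡ true → r ≡ s
  rep-unique {r} {s} rep-r rep-s rs with <-cmp r s
  ... | tri≈ _ r≡s _ = r≡s
  ... | tri< r<s _ _ = ⊥-elim (true≢false rs (not-true⁻ (⇒ᵇ-true⁻ (all-true⁻ rep-s (∈-allFin r)) (⌊⌋-true⁺ r<s))))
  ... | tri> _ _ s<r = ⊥-elim (true≢false (equiv-sym rs) (not-true⁻ (⇒ᵇ-true⁻ (all-true⁻ rep-r (∈-allFin s)) (⌊⌋-true⁺ s<r))))

  -- The edge ay lies in a maximal clique, which contains the twin x of y as well.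
  adj-twin : ∀ {a x y} → adj G a y ≡ true → equiv G x y ≡ true → equiv G a y ≡ false → adj G a x ≡ true
  adj-twin {a} {x} a∼y xy ay with edge⊆maxClique a∼y
  ... | K , K∈ , a∈K , y∈K = maxClique-isClique K∈ a x a∈K (equiv-∈ K∈ xy y∈K) a≢x
    where
    a≢x : ¬ a ≡ x
    a≢x refl = true≢false xy ay

  meets : VSet n → Fin n → Bool
  meets K r = any (λ v → (v ∈ᵇ K) ∧ equiv G r v) (vertices n)

  meets-true⁻ : ∀ {K r} → K ∈ maxCliques G → meets K r ≡ true → r ∈ᵇ K ≡ true
  meets-true⁻ {K} K∈ e with any-true⁻ (vertices n) e
  ... | v , _ , v∈K∧rv with ∧-true⁻ {v ∈ᵇ K} v∈K∧rv
  ... | v∈K , rv = equiv-∈ K∈ rv v∈K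

  meets-true⁺ : ∀ K {r} → r ∈ᵇ K ≡ true → meets K r ≡ true
  meets-true⁺ K {r} r∈K = any-true⁺ (∈-allFin r) (∧-true⁺ r∈K (equiv-refl r))

  meets-false⁺ : ∀ {K r} → K ∈ maxCliques G → r ∈ᵇ K ≡ false → meets K r ≡ false
  meets-false⁺ K∈ r∉K = ≢true⇒≡false (λ e → true≢false (meets-true⁻ K∈ e) r∉K)

  quotAdj-sym : ∀ r s → quotAdj G r s ≡ quotAdj G s r
  quotAdj-sym r s rewrite equiv-comm r s | Graph.sym G r s = refl

  quotAdj-irrefl : ∀ v → quotAdj G v v ≡ false
  quotAdj-irrefl v rewrite equiv-refl v = refl

  ∈-classes⁺ : ∀ {r} → isRep G r ≡ true → r ∈ classes G
  ∈-classes⁺ {r} = ∈-filter⁺ (λ r → isRep G r B.≟ true) (∈-allFin r)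

  ∈-classes⁻ : ∀ {r} → r ∈ classes G → isRep G r ≡ true
  ∈-classes⁻ r∈ = proj₂ (∈-filter⁻ (λ r → isRep G r B.≟ true) {xs = allFin n} r∈)

  classes-unique : Unique (classes G)
  classes-unique = Uniqueₚ.filter⁺ (λ r → isRep G r B.≟ true) (allFin⁺ n)

  distinct-classes-¬equiv : ∀ {r s} → r ∈ classes G → s ∈ classes G → ¬ r ≡ s → equiv G r s ≡ false
  distinct-classes-¬equiv r∈ s∈ r≢s = ≢true⇒≡false (r≢s ∘ rep-unique (∈-classes⁻ r∈) (∈-classes⁻ s∈))

  quotAdj-resp-equiv : ∀ {r r′ s s′} → equiv G r′ r ≡ true → equiv G s′ s ≡ true →
                       quotAdj G r s ≡ true → quotAdj G r′ s′ ≡ true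
  quotAdj-resp-equiv {r} {r′} {s} {s′} r′r s′s rs with ∧-true⁻ {not (equiv G r s)} rs
  ... | ¬rs , r∼s = ∧-true⁺ (not-true⁺ r′≁s′) (trans (Graph.sym G r′ s′) (adj-twin s′∼r r′r s′≁r))
    where
    r′≁s′ : equiv G r′ s′ ≡ false
    r′≁s′ = ≢true⇒≡false (λ e → true≢false (equiv-trans (equiv-sym r′r) (equiv-trans e s′s)) (not-true⁻ ¬rs))
    s′≁r : equiv G s′ r ≡ false
    s′≁r = ≢true⇒≡false (λ e → true≢false (equiv-trans (equiv-sym e) s′s) (not-true⁻ ¬rs))
    s′∼r : adj G s′ r ≡ true
    s′∼r = trans (Graph.sym G s′ r) (adj-twin r∼s s′s (not-true⁻ ¬rs))

  quotAdj-in-maxClique : ∀ {K x y} → K ∈ maxCliques G → x ∈ᵇ K ≡ true → y ∈ᵇ K ≡ true →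
                         equiv G x y ≡ false → quotAdj G x y ≡ true
  quotAdj-in-maxClique {x = x} K∈ x∈K y∈K xy = ∧-true⁺ (not-true⁺ xy) (maxClique-isClique K∈ _ _ x∈K y∈K x≢y)
    where
    x≢y : ¬ x ≡ _
    x≢y refl = true≢false (equiv-refl x) xy

  classes-in-maxClique-adjacent : ∀ {K x y} → K ∈ maxCliques G → x ∈ classes G → y ∈ classes G →
                                  meets K x ≡ true → meets K y ≡ true → ¬ x ≡ y → quotAdj G x y ≡ true
  classes-in-maxClique-adjacent K∈ x∈ y∈ mx my x≢y =
    quotAdj-in-maxClique K∈ (meets-true⁻ K∈ mx) (meets-true⁻ K∈ my) (distinct-classes-¬equiv x∈ y∈ x≢y)

  classesMeeting≤ω̃ : ∀ {K} → K ∈ maxCliques G → classesMeeting G K ≤ ω̃ G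
  classesMeeting≤ω̃ = ≤-maximum (classesMeeting G)

  quotDeg≤Δ̃ : ∀ {r} → r ∈ classes G → quotDeg G r ≤ Δ̃ G
  quotDeg≤Δ̃ = ≤-maximum (quotDeg G)

module QuotientBounds {n : ℕ} (G : Graph n) where
  open Cliques G
  open Twins G

  meetsBesides : VSet n → Fin n → Fin n → Bool
  meetsBesides K a r = meets K r ∧ not ⌊ r ≟ a ⌋

  classesMeeting≤1+besides : ∀ K a → classesMeeting G K ≤ 1 + count (meetsBesides K a) (classes G)
  classesMeeting≤1+besides K a = begin
      classesMeeting G K
    ≡⟨ count-split (meets K) (λ r → ⌊ r ≟ a ⌋) (classes G) ⟩
      count (λ r → meets K r ∧ ⌊ r ≟ a ⌋) (classes G) + count (meetsBesides K a) (classes G)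
    ≤⟨ +-monoˡ-≤ _ (count≤1 _ classes-unique is-a) ⟩
      1 + count (meetsBesides K a) (classes G) ∎
    where
    open ≤-Reasoning
    is-a : ∀ {x y} → x ∈ classes G → y ∈ classes G →
           (meets K x ∧ ⌊ x ≟ a ⌋) ≡ true → (meets K y ∧ ⌊ y ≟ a ⌋) ≡ true → x ≡ y
    is-a {x} {y} _ _ ex ey =
      trans (⌊⌋-true⁻ (proj₂ (∧-true⁻ {meets K x} ex))) (≡-sym (⌊⌋-true⁻ (proj₂ (∧-true⁻ {meets K y} ey))))

  besides<classesMeeting : ∀ K {a} → a ∈ classes G → a ∈ᵇ K ≡ true →
                           count (meetsBesides K a) (classes G) < classesMeeting G K
  besides<classesMeeting K {a} a∈ a∈K =
    count-mono-< (meetsBesides K a) (meets K) (classes G) (λ _ e → proj₁ (∧-true⁻ e)) a∈ (meets-true⁺ K a∈K) a-excluded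
    where
    a-excluded : meetsBesides K a a ≡ false
    a-excluded rewrite ⌊⌋-true⁺ {d = a ≟ a} refl = ∧-zeroʳ (meets K a)

  quotDeg≤cideg*[ω̃∸1] : ∀ {a} → a ∈ classes G → quotDeg G a ≤ cideg G * (ω̃ G ∸ 1)
  quotDeg≤cideg*[ω̃∸1] {a} a∈ = begin
      quotDeg G a
    ≤⟨ count≤sum-count (λ r → quotAdj G r a) (λ K → meetsBesides K a) (cliquesAt a) (classes G) cover ⟩
      sum (map (λ K → count (meetsBesides K a) (classes G)) (cliquesAt a))
    ≤⟨ sum-map-≤ _ (ω̃ G ∸ 1) (cliquesAt a) besides≤ω̃∸1 ⟩
      length (cliquesAt a) * (ω̃ G ∸ 1)
    ≤⟨ *-monoˡ-≤ (ω̃ G ∸ 1) (≤-maximum (λ v → length (cliquesAt v)) (∈-allFin a)) ⟩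
      cideg G * (ω̃ G ∸ 1) ∎
    where
    open ≤-Reasoning
    cover : ∀ {r} → r ∈ classes G → quotAdj G r a ≡ true →
            ∃ λ K → K ∈ cliquesAt a × meetsBesides K a r ≡ true
    cover {r} _ ra with ∧-true⁻ {not (equiv G r a)} ra
    ... | ¬ra , r∼a with edge⊆maxClique r∼a
    ... | K , K∈ , r∈K , a∈K = K , ∈-filter⁺ (λ K → (a ∈ᵇ K) B.≟ true) K∈ a∈K ,
      ∧-true⁺ (meets-true⁺ K r∈K) (not-true⁺ (≢true⇒≡false λ r≟a →
        true≢false (subst (λ z → equiv G r z ≡ true) (⌊⌋-true⁻ r≟a) (equiv-refl r)) (not-true⁻ ¬ra)))
    besides≤ω̃∸1 : ∀ {K} → K ∈ cliquesAt a → count (meetsBesides K a) (classes G) ≤ ω̃ G ∸ 1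
    besides≤ω̃∸1 {K} K∈ with ∈-filter⁻ (λ K → (a ∈ᵇ K) B.≟ true) {xs = maxCliques G} K∈
    ... | K∈max , a∈K = ∸-monoˡ-≤ 1 (≤-trans (besides<classesMeeting K a∈ a∈K) (classesMeeting≤ω̃ K∈max))

  Δ̃≤cideg*[ω̃∸1] : Δ̃ G ≤ cideg G * (ω̃ G ∸ 1)
  Δ̃≤cideg*[ω̃∸1] = maximum-≤ (quotDeg G) (classes G) quotDeg≤cideg*[ω̃∸1]

  edgeless⇒ω̃≤1 : QuotEdgeless G → ω̃ G ≤ 1
  edgeless⇒ω̃≤1 E = maximum-≤ (classesMeeting G) (maxCliques G) λ {K} K∈ →
    count≤1 (meets K) classes-unique (same-class K∈)
    where
    same-class : ∀ {K x y} → K ∈ maxCliques G → x ∈ classes G → y ∈ classes G →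
                 meets K x ≡ true → meets K y ≡ true → x ≡ y
    same-class {x = x} {y} K∈ x∈ y∈ mx my with x ≟ y
    ... | yes x≡y = x≡y
    ... | no x≢y = ⊥-elim (true≢false (classes-in-maxClique-adjacent K∈ x∈ y∈ mx my x≢y) (E x y))

  edgeless⇒Δ̃≡0 : QuotEdgeless G → Δ̃ G ≡ 0
  edgeless⇒Δ̃≡0 E = n≤0⇒n≡0 (maximum-≤ (quotDeg G) (classes G) λ {a} _ →
    ≤-reflexive (count-none (λ r → quotAdj G r a) (classes G) (λ {r} _ → E r a)))

  ¬edgeless⇒quotEdge : ¬ QuotEdgeless G → ∃ λ r → ∃ λ s → quotAdj G r s ≡ true
  ¬edgeless⇒quotEdge ¬E with any? (λ r → any? (λ s → quotAdj G r s B.≟ true))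
  ... | yes (r , s , rs) = r , s , rs
  ... | no none = ⊥-elim (¬E (λ r s → ≢true⇒≡false (λ rs → none (r , s , rs))))

  quotEdge⇒1≤Δ̃ : ∀ {r s} → quotAdj G r s ≡ true → 1 ≤ Δ̃ G
  quotEdge⇒1≤Δ̃ {r} {s} rs with rep r | rep s
  ... | r′ , rep-r′ , r′r | s′ , rep-s′ , s′s = ≤-trans
    (count-pos⁺ (λ t → quotAdj G t r′) (∈-classes⁺ rep-s′) (quotAdj-resp-equiv s′s r′r (trans (quotAdj-sym s r) rs)))
    (quotDeg≤Δ̃ (∈-classes⁺ rep-r′))

  -- The classes meeting K other than u are quotient neighbours of u, and so is the class of w, which misses K.
  classesMeeting≤quotDeg : ∀ {K u w} → K ∈ maxCliques G → u ∈ classes G → u ∈ᵇ K ≡ true → w ∈ᵇ K ≡ false →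
                           adj G u w ≡ true → classesMeeting G K ≤ quotDeg G u
  classesMeeting≤quotDeg {K} {u} {w} K∈ u∈ u∈K w∉K u∼w with rep w
  ... | w′ , rep-w′ , w′w = ≤-trans (classesMeeting≤1+besides K u)
    (count-mono-< (meetsBesides K u) (λ r → quotAdj G r u) (classes G) neighbour (∈-classes⁺ rep-w′) w′u w′-excluded)
    where
    w′∉K : w′ ∈ᵇ K ≡ false
    w′∉K = trans (equiv-true⁻ w′w K∈) w∉K
    w′u : quotAdj G w′ u ≡ true
    w′u = quotAdj-resp-equiv w′w (equiv-refl u)
      (∧-true⁺ (not-true⁺ (trans (equiv-comm w u) (separated⇒¬equiv K∈ u∈K w∉K))) (trans (Graph.sym G w u) u∼w))
    w′-excluded : meetsBesides K u w′ ≡ false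
    w′-excluded rewrite meets-false⁺ K∈ w′∉K = refl
    neighbour : ∀ {r} → r ∈ classes G → meetsBesides K u r ≡ true → quotAdj G r u ≡ true
    neighbour {r} r∈ e with ∧-true⁻ {meets K r} e
    ... | mr , r≢u = classes-in-maxClique-adjacent K∈ r∈ u∈ mr (meets-true⁺ K u∈K) (⌊⌋-false⁻ (not-true⁻ r≢u))

  separated-classes : ∀ {K} → K ∈ maxCliques G → 2 ≤ classesMeeting G K →
    ∃ λ u → u ∈ classes G × u ∈ᵇ K ≡ true × ∃ λ v → v ∈ᵇ K ≡ true ×
      ∃ λ K′ → K′ ∈ maxCliques G × u ∈ᵇ K′ ≡ true × v ∈ᵇ K′ ≡ false
  separated-classes {K} K∈ two with count-pos⁻ (meets K) (classes G) (≤-trans (s≤s z≤n) two)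
  ... | u , u∈ , mu with count-pos⁻ (meetsBesides K u) (classes G) (≤-pred (≤-trans two (classesMeeting≤1+besides K u)))
  ... | v , v∈ , mv with ∧-true⁻ {meets K v} mv
  ... | mv′ , v≢u with equiv-false⁻ (distinct-classes-¬equiv u∈ v∈ (λ u≡v → ⌊⌋-false⁻ (not-true⁻ v≢u) (≡-sym u≡v)))
  ... | K′ , K′∈ , differ with u ∈ᵇ K′ in u∈?K′ | v ∈ᵇ K′ in v∈?K′
  ... | true | true = ⊥-elim (differ refl)
  ... | false | false = ⊥-elim (differ refl)
  ... | true | false = u , u∈ , meets-true⁻ K∈ mu , v , meets-true⁻ K∈ mv′ , K′ , K′∈ , u∈?K′ , v∈?K′
  ... | false | true = v , v∈ , meets-true⁻ K∈ mv′ , u , meets-true⁻ K∈ mu , K′ , K′∈ , v∈?K′ , u∈?K′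

  leaves-maxClique : ∀ {K K′ u v} → K ∈ maxCliques G → K′ ∈ maxCliques G →
    u ∈ᵇ K ≡ true → v ∈ᵇ K ≡ true → u ∈ᵇ K′ ≡ true → v ∈ᵇ K′ ≡ false →
    ∃ λ x → x ∈ᵇ K ≡ false × adj G u x ≡ true
  leaves-maxClique {K} {K′} {u} {v} K∈ K′∈ u∈K v∈K u∈K′ v∉K′ with maxClique-non-neighbour K′∈ v∉K′
  ... | x , x∈K′ , x≁v = x , x∉K , maxClique-isClique K′∈ u x u∈K′ x∈K′ u≢x
    where
    x≢v : ¬ x ≡ v
    x≢v refl = true≢false x∈K′ v∉K′
    x∉K : x ∈ᵇ K ≡ false
    x∉K = ≢true⇒≡false λ x∈K → true≢false (maxClique-isClique K∈ x v x∈K v∈K x≢v) x≁v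
    u≢x : ¬ u ≡ x
    u≢x refl = true≢false u∈K x∉K

  classesMeeting≤Δ̃ : ∀ {K} → K ∈ maxCliques G → 2 ≤ classesMeeting G K → classesMeeting G K ≤ Δ̃ G
  classesMeeting≤Δ̃ K∈ two =
    let u , u∈ , u∈K , v , v∈K , K′ , K′∈ , u∈K′ , v∉K′ = separated-classes K∈ two
        x , x∉K , u∼x = leaves-maxClique K∈ K′∈ u∈K v∈K u∈K′ v∉K′
    in ≤-trans (classesMeeting≤quotDeg K∈ u∈ u∈K x∉K u∼x) (quotDeg≤Δ̃ u∈)

  ω̃≤Δ̃ : ¬ QuotEdgeless G → ω̃ G ≤ Δ̃ G
  ω̃≤Δ̃ ¬E with ¬edgeless⇒quotEdge ¬E
  ... | _ , _ , rs = maximum-≤ (classesMeeting G) (maxCliques G) λ {K} K∈ → case-split K∈ (classesMeeting G K ≤? 1)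
    where
    case-split : ∀ {K} → K ∈ maxCliques G → Dec (classesMeeting G K ≤ 1) → classesMeeting G K ≤ Δ̃ G
    case-split _ (yes ≤1) = ≤-trans ≤1 (quotEdge⇒1≤Δ̃ rs)
    case-split K∈ (no ≰1) = classesMeeting≤Δ̃ K∈ (≰⇒> ≰1)

module MoonMoser {n : ℕ} (E : Fin n → Fin n → Bool)
                 (E-sym : ∀ x y → E x y ≡ E y x) (E-irrefl : ∀ x → E x x ≡ false) where

  record MaximalCliqueOn (N : Fin n → Bool) (C : VSet n) : Set where
    field
      clique  : ∀ x y → N x ≡ true → N y ≡ true → x ∈ᵇ C ≡ true → y ∈ᵇ C ≡ true → ¬ x ≡ y → E x y ≡ true
      maximal : ∀ y → N y ≡ true → y ∈ᵇ C ≡ false → ∃ λ x → N x ≡ true × x ∈ᵇ C ≡ true × E x y ≡ false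
  open MaximalCliqueOn

  DifferOn : (Fin n → Bool) → VSet n → VSet n → Set
  DifferOn N C C′ = ∃ λ x → N x ≡ true × ¬ x ∈ᵇ C ≡ x ∈ᵇ C′

  card : (Fin n → Bool) → ℕ
  card N = count N (allFin n)

  nbhd : (Fin n → Bool) → Fin n → Fin n → Bool
  nbhd N q x = N x ∧ E q x

  nonNbhd : (Fin n → Bool) → Fin n → Fin n → Bool
  nonNbhd N p x = N x ∧ not (E x p)

  deg : (Fin n → Bool) → Fin n → ℕ
  deg N q = card (nbhd N q)

  containing : Fin n → List (VSet n) → List (VSet n)
  containing q = filter (λ C → (q ∈ᵇ C) B.≟ true)

  deg<card : ∀ N {q} → N q ≡ true → deg N q < card N
  deg<card N {q} Nq = count-mono-< (nbhd N q) N (allFin n) (λ _ e → proj₁ (∧-true⁻ e)) (∈-allFin q) Nq q∉nbhd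
    where
    q∉nbhd : nbhd N q q ≡ false
    q∉nbhd rewrite E-irrefl q = ∧-zeroʳ (N q)

  card-split : ∀ N p → card N ≡ deg N p + card (nonNbhd N p)
  card-split N p = trans (count-split N (λ x → E x p) (allFin n))
    (cong (_+ card (nonNbhd N p)) (count-cong _ _ (allFin n) (λ {x} _ → cong (N x ∧_) (E-sym x p))))

  max-degree-vertex : ∀ N → 1 ≤ card N → ∃ λ p → N p ≡ true × ∀ {q} → N q ≡ true → deg N q ≤ deg N p
  max-degree-vertex N N≢∅ with count-pos⁻ N (allFin n) N≢∅
  ... | x , x∈ , Nx with argmax-on (deg N) N (allFin n) x∈ Nx
  ... | p , Np , maximal = p , Np , λ {q} → maximal (∈-allFin q)

  maximal-in-nbhd : ∀ {N C q} → MaximalCliqueOn N C → N q ≡ true → q ∈ᵇ C ≡ true → MaximalCliqueOn (nbhd N q) C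
  maximal-in-nbhd {N} {C} {q} mc Nq q∈C = record
    { clique = λ x y Nx Ny → clique mc x y (proj₁ (∧-true⁻ Nx)) (proj₁ (∧-true⁻ Ny))
    ; maximal = λ y Ny y∉C → extend y Ny (maximal mc y (proj₁ (∧-true⁻ Ny)) y∉C)
    }
    where
    extend : ∀ y → nbhd N q y ≡ true → (∃ λ x → N x ≡ true × x ∈ᵇ C ≡ true × E x y ≡ false) →
             ∃ λ x → nbhd N q x ≡ true × x ∈ᵇ C ≡ true × E x y ≡ false
    extend y Ny (x , Nx , x∈C , x≁y) = x , ∧-true⁺ Nx (clique mc q x Nq Nx q∈C x∈C q≢x) , x∈C , x≁y
      where
      q≢x : ¬ q ≡ x
      q≢x refl = true≢false (proj₂ (∧-true⁻ {N y} Ny)) x≁y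

  -- A vertex separating C and C′ lies in one of them, hence is adjacent to the common vertex q.
  differ-in-nbhd : ∀ {N C C′ q} → MaximalCliqueOn N C → MaximalCliqueOn N C′ → N q ≡ true →
                   q ∈ᵇ C ≡ true → q ∈ᵇ C′ ≡ true → DifferOn N C C′ → DifferOn (nbhd N q) C C′
  differ-in-nbhd {N} {C} {C′} {q} mc mc′ Nq q∈C q∈C′ (x , Nx , differ) with x ∈ᵇ C in x∈?C | x ∈ᵇ C′ in x∈?C′
  ... | true | true = ⊥-elim (differ refl)
  ... | false | false = ⊥-elim (differ refl)
  ... | true | false = x , ∧-true⁺ Nx (clique mc q x Nq Nx q∈C x∈?C q≢x) , λ e → true≢false (trans (≡-sym e) x∈?C) x∈?C′
    where
    q≢x : ¬ q ≡ x
    q≢x refl = true≢false q∈C′ x∈?C′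
  ... | false | true = x , ∧-true⁺ Nx (clique mc′ q x Nq Nx q∈C′ x∈?C′ q≢x) , λ e → true≢false (trans e x∈?C′) x∈?C
    where
    q≢x : ¬ q ≡ x
    q≢x refl = true≢false q∈C x∈?C

  family-in-nbhd : ∀ {N q L} → N q ≡ true → All (MaximalCliqueOn N) L → AllPairs (DifferOn N) L →
    All (MaximalCliqueOn (nbhd N q)) (containing q L) × AllPairs (DifferOn (nbhd N q)) (containing q L)
  family-in-nbhd {N} {q} {L} Nq mcs diffs =
    All.map (λ (mc , q∈C) → maximal-in-nbhd mc Nq q∈C) members ,
    AllPairs-map-with-All (λ {C} {C′} (mc , q∈C) (mc′ , q∈C′) → differ-in-nbhd {C = C} {C′} mc mc′ Nq q∈C q∈C′)
                          members (AllPairsₚ.filter⁺ (λ C → (q ∈ᵇ C) B.≟ true) diffs)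
    where
    members : All (λ C → MaximalCliqueOn N C × q ∈ᵇ C ≡ true) (containing q L)
    members = All.zip (Allₚ.filter⁺ (λ C → (q ∈ᵇ C) B.≟ true) mcs , Allₚ.all-filter (λ C → (q ∈ᵇ C) B.≟ true) L)

  meets-nonNbhd : ∀ {N C p} → MaximalCliqueOn N C → N p ≡ true → ∃ λ s → nonNbhd N p s ≡ true × s ∈ᵇ C ≡ true
  meets-nonNbhd {N} {C} {p} mc Np with p ∈ᵇ C in p∈?C
  ... | true = p , ∧-true⁺ Np (not-true⁺ (E-irrefl p)) , p∈?C
  ... | false with maximal mc p Np p∈?C
  ... | x , Nx , x∈C , x≁p = x , ∧-true⁺ Nx (not-true⁺ x≁p) , x∈C

  length≤1-if-card≡0 : ∀ N → ¬ 1 ≤ card N → ∀ {L} → AllPairs (DifferOn N) L → length L ≤ 1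
  length≤1-if-card≡0 N N≡∅ {[]} _ = z≤n
  length≤1-if-card≡0 N N≡∅ {_ ∷ []} _ = ≤-refl
  length≤1-if-card≡0 N N≡∅ {_ ∷ _ ∷ _} (((x , Nx , _) ∷ _) ∷ _) = ⊥-elim (N≡∅ (count-pos⁺ N (∈-allFin x) Nx))

  -- Each C contains a vertex of S (p itself, or the witness of maximality for p), so L is covered by
  -- the subfamilies containing q ∈ S, each living on the neighbourhood of q.
  moonMoser-step : ∀ N p → N p ≡ true → (∀ {q} → N q ≡ true → deg N q ≤ deg N p) →
    (∀ {q} → N q ≡ true → ∀ L → All (MaximalCliqueOn (nbhd N q)) L → AllPairs (DifferOn (nbhd N q)) L →
       length L ^ 3 ≤ 3 ^ deg N q) →
    ∀ L → All (MaximalCliqueOn N) L → AllPairs (DifferOn N) L → length L ^ 3 ≤ 3 ^ card N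
  moonMoser-step N p Np p-max IH L mcs diffs = begin
      length L ^ 3
    ≡⟨ cong (_^ 3) (≡-sym (count-const-true L)) ⟩
      count (λ _ → true) L ^ 3
    ≤⟨ ^-monoˡ-≤ 3 (count≤sum-count (λ _ → true) (λ q C → q ∈ᵇ C) S L cover) ⟩
      sum (map (λ q → length (containing q L)) S) ^ 3
    ≤⟨ sum-map-^3-≤ (λ q → length (containing q L)) S bound ⟩
      card (nonNbhd N p) ^ 3 * 3 ^ deg N p
    ≤⟨ *-monoˡ-≤ (3 ^ deg N p) (n^3≤3^n (card (nonNbhd N p))) ⟩
      3 ^ card (nonNbhd N p) * 3 ^ deg N p
    ≡⟨ ≡-sym (^-distribˡ-+-* 3 (card (nonNbhd N p)) (deg N p)) ⟩
      3 ^ (card (nonNbhd N p) + deg N p)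
    ≡⟨ cong (3 ^_) (trans (+-comm (card (nonNbhd N p)) (deg N p)) (≡-sym (card-split N p))) ⟩
      3 ^ card N ∎
    where
    open ≤-Reasoning
    S : List (Fin n)
    S = filter (λ x → nonNbhd N p x B.≟ true) (allFin n)
    cover : ∀ {C} → C ∈ L → true ≡ true → ∃ λ q → q ∈ S × q ∈ᵇ C ≡ true
    cover C∈ _ with meets-nonNbhd (All.lookup mcs C∈) Np
    ... | s , s∈S , s∈C = s , ∈-filter⁺ (λ x → nonNbhd N p x B.≟ true) (∈-allFin s) s∈S , s∈C
    bound : ∀ {q} → q ∈ S → length (containing q L) ^ 3 ≤ 3 ^ deg N p
    bound q∈S with ∧-true⁻ (proj₂ (∈-filter⁻ (λ x → nonNbhd N p x B.≟ true) {xs = allFin n} q∈S))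
    ... | Nq , _ with family-in-nbhd Nq mcs diffs
    ... | mcs′ , diffs′ = ≤-trans (IH Nq _ mcs′ diffs′) (^-monoʳ-≤ 3 (p-max Nq))

  moonMoser-fuel : ∀ m N → card N ≤ m →
    ∀ L → All (MaximalCliqueOn N) L → AllPairs (DifferOn N) L → length L ^ 3 ≤ 3 ^ card N
  moonMoser-fuel m N N≤m with 1 ≤? card N
  ... | no N≡∅ = λ L _ diffs → ≤-trans (^-monoˡ-≤ 3 (length≤1-if-card≡0 N N≡∅ diffs)) (m^n>0 3 (card N))
  moonMoser-fuel zero N N≤0 | yes N≢∅ = ⊥-elim (1+n≰n (≤-trans N≢∅ N≤0))
  moonMoser-fuel (suc m) N N≤m | yes N≢∅ with max-degree-vertex N N≢∅
  ... | p , Np , p-max = moonMoser-step N p Np p-max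
          (λ {q} Nq → moonMoser-fuel m (nbhd N q) (≤-pred (≤-trans (deg<card N Nq) N≤m)))

  moonMoser : ∀ N L → All (MaximalCliqueOn N) L → AllPairs (DifferOn N) L → length L ^ 3 ≤ 3 ^ card N
  moonMoser N = moonMoser-fuel (card N) N ≤-refl

module CliqueDegreeBound {n : ℕ} (G : Graph n) where
  open Cliques G
  open Twins G
  open MoonMoser (quotAdj G) quotAdj-sym quotAdj-irrefl

  quotNbhd : Fin n → Fin n → Bool
  quotNbhd v r = isRep G r ∧ quotAdj G r v

  maxClique-maximal-on-quotNbhd : ∀ {K v} → K ∈ maxCliques G → v ∈ᵇ K ≡ true → MaximalCliqueOn (quotNbhd v) K
  maxClique-maximal-on-quotNbhd {K} {v} K∈ v∈K = record
    { clique = λ x y Nx Ny x∈K y∈K x≢y →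
        ∧-true⁺ (not-true⁺ (≢true⇒≡false (x≢y ∘ rep-unique (proj₁ (∧-true⁻ Nx)) (proj₁ (∧-true⁻ Ny)))))
                (maxClique-isClique K∈ x y x∈K y∈K x≢y)
    ; maximal = maximal
    }
    where
    maximal : ∀ y → quotNbhd v y ≡ true → y ∈ᵇ K ≡ false →
              ∃ λ x → quotNbhd v x ≡ true × x ∈ᵇ K ≡ true × quotAdj G x y ≡ false
    maximal y Ny y∉K with maxClique-non-neighbour K∈ y∉K | ∧-true⁻ {not (equiv G y v)} (proj₂ (∧-true⁻ {isRep G y} Ny))
    ... | z , z∈K , z≁y | ¬yv , y∼v with equiv G z v in zv
    ... | true = ⊥-elim (true≢false (trans (Graph.sym G z y) (adj-twin y∼v zv (not-true⁻ ¬yv))) z≁y)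
    ... | false with rep z
    ... | x , rep-x , xz = x , ∧-true⁺ rep-x xv , x∈K , ≢true⇒≡false xy
      where
      x∈K = equiv-∈ K∈ xz z∈K
      x≁v : equiv G x v ≡ false
      x≁v = ≢true⇒≡false (λ e → true≢false (equiv-trans (equiv-sym xz) e) zv)
      xv : quotAdj G x v ≡ true
      xv = quotAdj-in-maxClique K∈ x∈K v∈K x≁v
      xy : ¬ quotAdj G x y ≡ true
      xy e = true≢false (proj₂ (∧-true⁻ {not (equiv G z y)} (quotAdj-resp-equiv (equiv-sym xz) (equiv-refl y) e))) z≁y

  maxCliques-differ-on-quotNbhd : ∀ {K K′ v} → K ∈ maxCliques G → K′ ∈ maxCliques G →
    v ∈ᵇ K ≡ true → v ∈ᵇ K′ ≡ true → ¬ K ≡ K′ → DifferOn (quotNbhd v) K K′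
  maxCliques-differ-on-quotNbhd {K} {K′} {v} K∈ K′∈ v∈K v∈K′ K≢K′
    with any? (λ z → ¬? ((z ∈ᵇ K) B.≟ (z ∈ᵇ K′)))
  ... | no none = ⊥-elim (K≢K′ (vset-ext λ z → decidable-stable ((z ∈ᵇ K) B.≟ (z ∈ᵇ K′)) (λ ne → none (z , ne))))
  ... | yes (z , differ) with equiv G z v in zv
  ... | true = ⊥-elim (differ (trans (equiv-∈ K∈ zv v∈K) (≡-sym (equiv-∈ K′∈ zv v∈K′))))
  ... | false with rep z
  ... | x , rep-x , xz = x , ∧-true⁺ rep-x xv ,
        λ e → differ (trans (≡-sym (equiv-true⁻ xz K∈)) (trans e (equiv-true⁻ xz K′∈)))
    where
    z-side : ∃ λ C → C ∈ maxCliques G × z ∈ᵇ C ≡ true × v ∈ᵇ C ≡ true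
    z-side with z ∈ᵇ K in z∈?K | z ∈ᵇ K′ in z∈?K′
    ... | true | _ = K , K∈ , z∈?K , v∈K
    ... | false | true = K′ , K′∈ , z∈?K′ , v∈K′
    ... | false | false = ⊥-elim (differ refl)
    x≁v : equiv G x v ≡ false
    x≁v = ≢true⇒≡false (λ e → true≢false (equiv-trans (equiv-sym xz) e) zv)
    xv : quotAdj G x v ≡ true
    xv = let C , C∈ , z∈C , v∈C = z-side in quotAdj-in-maxClique C∈ (equiv-∈ C∈ xz z∈C) v∈C x≁v

  cliquesAt-cubed : ∀ {v v′} → isRep G v′ ≡ true → equiv G v′ v ≡ true → length (cliquesAt v) ^ 3 ≤ 3 ^ Δ̃ G
  cliquesAt-cubed {v} {v′} rep-v′ v′v = begin
      length (cliquesAt v) ^ 3  ≤⟨ moonMoser (quotNbhd v′) (cliquesAt v) maximal distinct ⟩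
      3 ^ card (quotNbhd v′)    ≤⟨ ^-monoʳ-≤ 3 card≤Δ̃ ⟩
      3 ^ Δ̃ G                   ∎
    where
    open ≤-Reasoning
    members : All (λ K → K ∈ maxCliques G × v′ ∈ᵇ K ≡ true) (cliquesAt v)
    members = All.tabulate λ K∈ →
      let K∈max , v∈K = ∈-filter⁻ (λ K → (v ∈ᵇ K) B.≟ true) {xs = maxCliques G} K∈ in K∈max , equiv-∈ K∈max v′v v∈K
    maximal : All (MaximalCliqueOn (quotNbhd v′)) (cliquesAt v)
    maximal = All.map (λ (K∈ , v′∈K) → maxClique-maximal-on-quotNbhd K∈ v′∈K) members
    distinct : AllPairs (DifferOn (quotNbhd v′)) (cliquesAt v)
    distinct = AllPairs-map-with-All (λ (K∈ , v′∈K) (K′∈ , v′∈K′) → maxCliques-differ-on-quotNbhd K∈ K′∈ v′∈K v′∈K′)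
      members (AllPairsₚ.filter⁺ (λ K → (v ∈ᵇ K) B.≟ true) maxCliques-unique)
    card≤Δ̃ : card (quotNbhd v′) ≤ Δ̃ G
    card≤Δ̃ = ≤-trans (≤-reflexive (≡-sym (count-filter (isRep G) (λ r → quotAdj G r v′) (allFin n))))
                     (quotDeg≤Δ̃ (∈-classes⁺ rep-v′))

  cideg≤3^⌈Δ̃/3⌉ : cideg G ≤ 3 ^ ceil3 (Δ̃ G)
  cideg≤3^⌈Δ̃/3⌉ = maximum-≤ (λ v → length (cliquesAt v)) (allFin n) λ {v} _ →
    let v′ , rep-v′ , v′v = rep v in m^3≤n^3⇒m≤n (begin
      length (cliquesAt v) ^ 3  ≤⟨ cliquesAt-cubed rep-v′ v′v ⟩
      3 ^ Δ̃ G                   ≤⟨ ^-monoʳ-≤ 3 (m≤⌈m/3⌉*3 (Δ̃ G)) ⟩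
      3 ^ (ceil3 (Δ̃ G) * 3)     ≡⟨ ≡-sym (^-*-assoc 3 (ceil3 (Δ̃ G)) 3) ⟩
      (3 ^ ceil3 (Δ̃ G)) ^ 3     ∎)
    where open ≤-Reasoning

lemma3p4 : ∀ {n : ℕ} (G : Graph n) →
    ((¬ QuotEdgeless G → ω̃ G ≤ Δ̃ G) × (QuotEdgeless G → ω̃ G ≤ 1 × Δ̃ G ≡ 0))
    × cideg G ≤ 3 ^ ceil3 (Δ̃ G)
    × Δ̃ G ≤ cideg G * (ω̃ G ∸ 1)
lemma3p4 G =
  (ω̃≤Δ̃ , λ edgeless → edgeless⇒ω̃≤1 edgeless , edgeless⇒Δ̃≡0 edgeless) , cideg≤3^⌈Δ̃/3⌉ , Δ̃≤cideg*[ω̃∸1]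
  where
  open QuotientBounds G
  open CliqueDegreeBound G
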